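{- Let $G$ and $H$ be general coronas of some trees (i.e. $G=T_1\circ\mathcal{P}_1$, $H=T_2\circ\mathcal{P}_2$ for trees $T_1,T_2$ and vertex neighborhood partitions $\mathcal{P}_1,\mathcal{P}_2$). Suppose $G$ and $H$ share exactly one vertex $w$, and $w$ is an external vertex of $G$ and an external vertex of $H$. Then the union $G\cup H$ is (isomorphic to) a general corona of some tree.
   Context: For a graph $T$, a vertex neighborhood partition is a family $\mathcal{P}=\{\mathcal{P}(v): v\in V(T)\}$ where each $\mathcal{P}(v)$ is a partition of $N_T(v)$ into nonempty parts. The general corona $T\circ\mathcal{P}$ has vertex set $\{(v,1): v\in V(T)\}\cup\bigcup_{v\in V(T)}\{(v,A): A\in\mathcal{P}(v)\}$ and edge set $\bigcup_{v}\{(v,1)(v,A): A\in\mathcal{P}(v)\}\cup\bigcup_{uv\in E(T)}\{(v,A)(u,B): u\in A,\ v\in B\}$. The vertices $(v,1)$ are called external; the others internal. $G\cup H$ denotes the graph with vertex set $V(G)\cup V(H)$ and edge set $E(G)\cup E(H)$. -}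

module Defs where

open import Data.Nat using (ℕ; _≤_)
open import Data.Fin using (Fin)
open import Data.Bool using (Bool; true; false; T; _∨_)
open import Data.Bool.Properties using (T-∨)
open import Data.Unit using (⊤)
open import Data.Empty using (⊥)
open import Data.Sum using (_⊎_; inj₁; inj₂)
open import Data.Product using (Σ; _×_; _,_; proj₁; proj₂; ∃)
open import Data.List using (List; []; _∷_; _++_; take; length)
open import Data.List.Relation.Unary.Linked using (Linked)
open import Data.List.Relation.Unary.Unique.Propositional using (Unique)
open import Relation.Binary.PropositionalEquality using (_≡_)
open import Relation.Nullary using (¬_)
open import Function using (_⇔_; _↔_; Inverse)
open import Function.Bundles using (Equivalence)

record Graph : Set₁ where
  field
    Vtx : Set
    Adj : Vtx → Vtx → Set

open Graph public

Iso : Graph → Graph → Set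
Iso G H = Σ (Vtx G ↔ Vtx H) λ f →
  ∀ x y → Adj G x y ⇔ Adj H (Inverse.to f x) (Inverse.to f y)

module _ {n : ℕ} (adj : Fin n → Fin n → Bool) where

  Edge : Fin n → Fin n → Set
  Edge u v = T (adj u v)

  data Walk (u : Fin n) : Fin n → Set where
    here : Walk u u
    step : ∀ {v w} → Walk u v → Edge v w → Walk u w

  -- A cycle: k ≥ 3 pairwise distinct vertices v₀ … v_{k-1} with
  -- v_i v_{i+1} edges and v_{k-1} v₀ an edge.
  Cycle : Set
  Cycle = Σ (List (Fin n)) λ xs →
    (3 ≤ length xs) × Unique xs × Linked Edge (xs ++ take 1 xs)

record Tree : Set where
  field
    size      : ℕ
    nonempty  : 1 ≤ size
    adj       : Fin size → Fin size → Bool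
    symmetric : ∀ u v → T (adj u v) → T (adj v u)
    loopless  : ∀ v → adj v v ≡ false
    connected : ∀ u v → Walk adj u v
    acyclic   : ¬ Cycle adj

open Tree public

-- P(v) is a partition of N_T(v) into
-- nonempty parts; the parts of P(v) are indexed by Fin (parts v), and
-- label v u e is the part of P(v) containing the neighbour u.

record VNPartition (t : Tree) : Set where
  field
    parts : Fin (size t) → ℕ
    label : ∀ v u → T (adj t v u) → Fin (parts v)
    nonemptyParts : ∀ v (A : Fin (parts v)) →
      Σ (Fin (size t)) λ u → Σ (T (adj t v u)) λ e → label v u e ≡ A

open VNPartition public

-- The general corona T ∘ P.
-- inj₁ v        is the external vertex (v,1);
-- inj₂ (v , A)  is the internal vertex (v,A), A ∈ P(v).

module _ (t : Tree) (P : VNPartition t) where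

  CVtx : Set
  CVtx = Fin (size t) ⊎ Σ (Fin (size t)) (λ v → Fin (parts P v))

  CAdj : CVtx → CVtx → Set
  CAdj (inj₁ v) (inj₁ u) = ⊥
  CAdj (inj₁ v) (inj₂ (u , A)) = v ≡ u
  CAdj (inj₂ (v , A)) (inj₁ u) = v ≡ u
  CAdj (inj₂ (v , A)) (inj₂ (u , B)) =
    Σ (T (adj t v u)) λ e → Σ (T (adj t u v)) λ e' →
      (label P v u e ≡ A) × (label P u v e' ≡ B)

corona : (t : Tree) → VNPartition t → Graph
corona t P = record { Vtx = CVtx t P ; Adj = CAdj t P }

-- Graphs whose vertex sets live in a common ambient type U, so that they
-- may share vertices; and their union G ∪ H.

record GraphIn (U : Set) : Set₁ where
  field
    V : U → Bool
    E : U → U → Set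
    E-sym  : ∀ x y → E x y → E y x
    E-vert : ∀ x y → E x y → T (V x) × T (V y)

open GraphIn public

asGraph : {U : Set} → GraphIn U → Graph
asGraph G = record
  { Vtx = Σ _ (λ x → T (V G x))
  ; Adj = λ x y → E G (proj₁ x) (proj₁ y) }

private
  T-∨ˡ : ∀ {a b} → T a → T (a ∨ b)
  T-∨ˡ p = Equivalence.from T-∨ (inj₁ p)
  T-∨ʳ : ∀ {a b} → T b → T (a ∨ b)
  T-∨ʳ p = Equivalence.from T-∨ (inj₂ p)

_∪_ : {U : Set} → GraphIn U → GraphIn U → GraphIn U
G ∪ H = record
  { V = λ x → V G x ∨ V H x
  ; E = λ x y → E G x y ⊎ E H x y
  ; E-sym = λ { x y (inj₁ e) → inj₁ (E-sym G x y e)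
              ; x y (inj₂ e) → inj₂ (E-sym H x y e) }
  ; E-vert = λ { x y (inj₁ e) → T-∨ˡ (proj₁ (E-vert G x y e)) , T-∨ˡ (proj₂ (E-vert G x y e))
               ; x y (inj₂ e) → T-∨ʳ (proj₁ (E-vert H x y e)) , T-∨ʳ (proj₂ (E-vert H x y e)) }
  }

IsGeneralCoronaOfTree : Graph → Set
IsGeneralCoronaOfTree G =
  Σ Tree λ t → Σ (VNPartition t) λ P → Iso (corona t P) G

CVtxExt : Tree → Set
CVtxExt t = Fin (size t)

ext : (t : Tree) (P : VNPartition t) → CVtxExt t → CVtx t P
ext t P v = inj₁ v

-- Identifying v₁ with v₂ glues T₁ and T₂ into a tree T: every vertex is joined
-- to the glued vertex, and a cycle, which would have to pass the glued vertex
-- twice to change sides, lies in T₁ or in T₂.  At the glued vertex take the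
-- partition P₁(v₁) ⊔ P₂(v₂), elsewhere the old ones.  Then T ∘ P is the
-- one-point union of T₁ ∘ P₁ and T₂ ∘ P₂ at (v₁,1) and (v₂,1); so is G ∪ H,
-- as G and H meet only in w; and two one-point unions of the same pointed
-- graphs are isomorphic.

module Submission where

open import Defs
open import Data.Bool using (Bool; true; false; T)
open import Data.Bool.Properties using (T?; T-irrelevant; T-∨)
open import Data.Empty using (⊥; ⊥-elim)
open import Data.Fin using (Fin; _↑ˡ_; _↑ʳ_; splitAt; punchIn; punchOut)
open import Data.Fin.Properties
  using (_≟_; 1↔⊤; +↔⊎; splitAt-↑ˡ; splitAt-↑ʳ; splitAt⁻¹-↑ˡ; splitAt⁻¹-↑ʳ;
         punchInᵢ≢i; punchIn-punchOut; punchOut-punchIn; punchOut-cong)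
open import Data.List using (List; []; _∷_; _++_; take; map)
open import Data.List.Properties using (++-assoc; length-map; map-++; take-map)
open import Data.List.Membership.Propositional.Properties using (∈-∃++)
import Data.List.Membership.DecPropositional as DecMembership
open import Data.List.Relation.Unary.All using (All; []; _∷_)
import Data.List.Relation.Unary.All as All
import Data.List.Relation.Unary.All.Properties as All
open import Data.List.Relation.Unary.AllPairs using ([]; _∷_)
open import Data.List.Relation.Unary.Linked using (Linked; []; [-]; _∷_)
import Data.List.Relation.Unary.Linked as Linked
open import Data.List.Relation.Unary.Unique.Propositional using (Unique)
open import Data.Nat using (ℕ; suc; _+_; _≤_; s≤s; z≤n)
open import Data.Product using (Σ; _×_; _,_; proj₁; proj₂)
import Data.Product as Product
open import Data.Sum using (_⊎_; inj₁; inj₂; [_,_])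
open import Data.Sum.Properties using (inj₁-injective; inj₂-injective)
open import Data.Sum.Function.Propositional using (_⊎-↔_)
open import Data.Unit using (⊤; tt)
open import Function using (_∘_; id; case_of_; Inverse; Injection; _↔_; _⇔_; mk⇔; mk↔ₛ′; Equivalence)
open import Function.Construct.Composition using (_↔-∘_; _⇔-∘_)
open import Function.Construct.Identity using (↔-id; ⇔-id)
open import Function.Construct.Symmetry using (⇔-sym)
open import Function.Properties.Inverse using (↔⇒↣)
open import Relation.Binary.Definitions using (DecidableEquality)
open import Relation.Binary.PropositionalEquality
  using (_≡_; _≢_; refl; sym; trans; cong; subst; subst₂; ≢-sym)
open import Relation.Nullary using (¬_; Dec; yes; no)
open import Relation.Nullary.Decidable using (False; fromWitnessFalse; toWitnessFalse)

-- Walks and cycles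

module _ {X : Set} {R : X → X → Set} where

  Linked-++⁻ˡ : ∀ xs {ys} → Linked R (xs ++ ys) → Linked R xs
  Linked-++⁻ˡ [] _ = []
  Linked-++⁻ˡ (x ∷ []) _ = [-]
  Linked-++⁻ˡ (x ∷ y ∷ xs) (r ∷ lk) = r ∷ Linked-++⁻ˡ (y ∷ xs) lk

  Linked-split : ∀ xs {y ys} → Linked R (xs ++ y ∷ ys) → Linked R (xs ++ y ∷ []) × Linked R (y ∷ ys)
  Linked-split [] lk = [-] , lk
  Linked-split (x ∷ []) (r ∷ lk) = r ∷ [-] , lk
  Linked-split (x ∷ x′ ∷ xs) (r ∷ lk) = Product.map₁ (r ∷_) (Linked-split (x′ ∷ xs) lk)

  Linked-join : ∀ xs {y ys} → Linked R (xs ++ y ∷ []) → Linked R (y ∷ ys) → Linked R (xs ++ y ∷ ys)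
  Linked-join [] _ lk = lk
  Linked-join (x ∷ []) (r ∷ _) lk = r ∷ lk
  Linked-join (x ∷ x′ ∷ xs) (r ∷ lk₁) lk = r ∷ Linked-join (x′ ∷ xs) lk₁ lk

Unique[xs++c∷ys]⇒c∉xs×ys : {X : Set} (xs : List X) {c : X} {ys : List X} →
  Unique (xs ++ c ∷ ys) → All (c ≢_) xs × All (c ≢_) ys
Unique[xs++c∷ys]⇒c∉xs×ys [] (c∉ys ∷ _) = [] , c∉ys
Unique[xs++c∷ys]⇒c∉xs×ys (x ∷ xs) (x∉ ∷ u) =
  Product.map₁ (≢-sym (All.head (All.++⁻ʳ xs x∉)) ∷_) (Unique[xs++c∷ys]⇒c∉xs×ys xs u)

-- Removing a cut vertex c from a cycle leaves a path, and a path avoiding c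
-- cannot cross from one side of c to the other.
module CutVertex {X : Set} (_≟_ : DecidableEquality X) (R : X → X → Set)
  (c : X) (side : X → Bool)
  (sameSide : ∀ {x y} → R x y → c ≢ x → c ≢ y → side x ≡ side y) where

  open DecMembership _≟_ using (_∈?_)

  OnSide : Bool → X → Set
  OnSide s y = c ≢ y → side y ≡ s

  avoiding-path-oneSided : ∀ {xs} → Linked R xs → All (c ≢_) xs → Σ Bool λ s → All (λ y → side y ≡ s) xs
  avoiding-path-oneSided [] [] = true , []
  avoiding-path-oneSided [-] (_ ∷ []) = _ , refl ∷ []
  avoiding-path-oneSided (r ∷ lk) (c≢x ∷ c≢ys@(c≢y ∷ _)) with avoiding-path-oneSided lk c≢ys
  ... | s , y≡s ∷ ys≡s = s , trans (sameSide r c≢x c≢y) y≡s ∷ y≡s ∷ ys≡s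

  private
    onSide : ∀ {s xs} → All (λ y → side y ≡ s) xs → All (OnSide s) xs
    onSide = All.map (λ y≡s _ → y≡s)

    c-onSide : ∀ {s} → OnSide s c
    c-onSide c≢c = ⊥-elim (c≢c refl)

    through-c-oneSided : ∀ xs ys → Unique (xs ++ c ∷ ys) →
      Linked R (xs ++ c ∷ ys ++ take 1 (xs ++ c ∷ ys)) → Σ Bool λ s → All (OnSide s) (xs ++ c ∷ ys)
    through-c-oneSided [] ys u lk =
      let s , ys≡s = avoiding-path-oneSided (Linked.tail (Linked-++⁻ˡ (c ∷ ys) lk))
                                            (proj₂ (Unique[xs++c∷ys]⇒c∉xs×ys [] u))
      in s , c-onSide ∷ onSide ys≡s
    through-c-oneSided (x ∷ xs) ys u lk =
      let before , after = Linked-split (x ∷ xs) lk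
          c∉xs , c∉ys = Unique[xs++c∷ys]⇒c∉xs×ys (x ∷ xs) u
          -- ys ++ x ∷ xs is the cycle read from c round to c
          s , around = avoiding-path-oneSided
                         (Linked-join ys (Linked.tail after) (Linked-++⁻ˡ (x ∷ xs) before))
                         (All.++⁺ c∉ys c∉xs)
          ys≡s , xs≡s = All.++⁻ ys around
      in s , All.++⁺ (onSide xs≡s) (c-onSide ∷ onSide ys≡s)

  cycle-oneSided : ∀ xs → Unique xs → Linked R (xs ++ take 1 xs) → Σ Bool λ s → All (OnSide s) xs
  cycle-oneSided xs u lk with c ∈? xs
  ... | no c∉xs =
    Product.map₂ onSide (avoiding-path-oneSided (Linked-++⁻ˡ xs lk) (All.¬Any⇒All¬ xs c∉xs))
  ... | yes c∈xs with ys , zs , refl ← ∈-∃++ c∈xs =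
    through-c-oneSided ys zs u (subst (Linked R) (++-assoc ys (c ∷ zs) _) lk)

module _ {m n} {adj : Fin m → Fin m → Bool} {adj′ : Fin n → Fin n → Bool} (f : Fin m → Fin n)
  (f-edge : ∀ {u v} → Edge adj u v → Edge adj′ (f u) (f v)) where

  mapWalk : ∀ {u v} → Walk adj u v → Walk adj′ (f u) (f v)
  mapWalk here = here
  mapWalk (step w e) = step (mapWalk w) (f-edge e)

_◅◅_ : ∀ {n} {adj : Fin n → Fin n → Bool} {u v w} → Walk adj u v → Walk adj v w → Walk adj u w
p ◅◅ here = p
p ◅◅ step q e = step (p ◅◅ q) e

module _ {m n} {adj : Fin m → Fin m → Bool} {adj′ : Fin n → Fin n → Bool}
  (P : Fin m → Set) (f : Fin m → Fin n)
  (f-injective : ∀ {x y} → P x → P y → f x ≡ f y → x ≡ y)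
  (f-edge : ∀ {x y} → P x → P y → Edge adj x y → Edge adj′ (f x) (f y)) where

  private
    map-Linked : ∀ {xs} → All P xs → Linked (Edge adj) xs → Linked (Edge adj′) (map f xs)
    map-Linked _ [] = []
    map-Linked _ [-] = [-]
    map-Linked (px ∷ py ∷ ps) (e ∷ lk) = f-edge px py e ∷ map-Linked (py ∷ ps) lk

    map-Unique : ∀ {xs} → All P xs → Unique xs → Unique (map f xs)
    map-Unique [] [] = []
    map-Unique (px ∷ ps) (x∉ ∷ u) =
      All.map⁺ (All.zipWith (λ (py , x≢y) → x≢y ∘ f-injective px py) (ps , x∉)) ∷ map-Unique ps u

  mapCycle : (cyc : Cycle adj) → All P (proj₁ cyc) → Cycle adj′
  mapCycle (xs , 3≤len , u , lk) ps =
    map f xs ,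
    subst (3 ≤_) (sym (length-map f xs)) 3≤len ,
    map-Unique ps u ,
    subst (Linked (Edge adj′))
          (trans (map-++ f xs (take 1 xs)) (cong (map f xs ++_) (sym (take-map 1 xs))))
      (map-Linked (All.++⁺ ps (All.take⁺ 1 ps)) lk)

-- General coronas and their isomorphisms

pattern external x = inj₁ x
pattern internal x A = inj₂ (x , A)

Σ-T-≡ : {X : Set} {P : X → Bool} {x y : X} {p : T (P x)} {q : T (P y)} →
  x ≡ y → _≡_ {A = Σ X (T ∘ P)} (x , p) (y , q)
Σ-T-≡ {p = p} {q} refl = cong (_ ,_) (T-irrelevant p q)

Iso-refl : ∀ A → Iso A A
Iso-refl A = ↔-id _ , λ x y → ⇔-id _

Iso-trans : ∀ {A B C} → Iso A B → Iso B C → Iso A C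
Iso-trans (f , f-adj) (g , g-adj) = g ↔-∘ f , λ x y → g-adj _ _ ⇔-∘ f-adj x y

-- Iso is not injective in its arguments, so a chain of isomorphisms is
-- written with its graphs spelled out, in the style of ≡-Reasoning.
module Iso-Reasoning where

  record _IsoTo_ (A B : Graph) : Set where
    constructor isoTo
    field iso : Iso A B

  infix  1 begin_
  infixr 2 _≅⟨_⟩_
  infix  3 _∎

  begin_ : ∀ {A B} → A IsoTo B → Iso A B
  begin isoTo i = i

  _≅⟨_⟩_ : ∀ A {B C} → Iso A B → B IsoTo C → A IsoTo C
  _≅⟨_⟩_ A {B} {C} i (isoTo j) = isoTo (Iso-trans {A} {B} {C} i j)

  _∎ : ∀ A → A IsoTo A
  A ∎ = isoTo (Iso-refl A)

module _ {X : Set} (adjX : X → X → Bool) (partsX : X → ℕ)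
  (labelX : ∀ x y → T (adjX x y) → Fin (partsX x)) where

  CoronaVtx : Set
  CoronaVtx = X ⊎ Σ X (Fin ∘ partsX)

  CoronaAdj : CoronaVtx → CoronaVtx → Set
  CoronaAdj (external _) (external _) = ⊥
  CoronaAdj (external x) (internal y _) = x ≡ y
  CoronaAdj (internal x _) (external y) = x ≡ y
  CoronaAdj (internal x A) (internal y B) =
    Σ (T (adjX x y)) λ e → Σ (T (adjX y x)) λ e′ → (labelX x y e ≡ A) × (labelX y x e′ ≡ B)

  coronaOn : Graph
  coronaOn = record { Vtx = CoronaVtx ; Adj = CoronaAdj }

  CoronaAdj-sym : ∀ v v′ → CoronaAdj v v′ → CoronaAdj v′ v
  CoronaAdj-sym (external _) (internal _ _) = sym
  CoronaAdj-sym (internal _ _) (external _) = sym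
  CoronaAdj-sym (internal _ _) (internal _ _) (e , e′ , l , l′) = e′ , e , l′ , l

CAdj-sym : (t : Tree) (P : VNPartition t) → ∀ v v′ → CAdj t P v v′ → CAdj t P v′ v
CAdj-sym t P (external _) (internal _ _) = sym
CAdj-sym t P (internal _ _) (external _) = sym
CAdj-sym t P (internal _ _) (internal _ _) (e , e′ , l , l′) = e′ , e , l′ , l

corona≅coronaOn : (t : Tree) (P : VNPartition t) →
  Iso (corona t P) (coronaOn (adj t) (parts P) (label P))
corona≅coronaOn t P = ↔-id _ , λ where
  (external _) (external _) → mk⇔ id id
  (external _) (internal _ _) → mk⇔ id id
  (internal _ _) (external _) → mk⇔ id id
  (internal _ _) (internal _ _) → mk⇔ id id

module _ {X Y : Set} (f : Y ↔ X) {adjX : X → X → Bool} {partsX : X → ℕ}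
  {labelX : ∀ x y → T (adjX x y) → Fin (partsX x)} where

  open Inverse f

  private
    F : X → Set
    F = Fin ∘ partsX

    adjY : Y → Y → Bool
    adjY y y′ = adjX (to y) (to y′)

    labelY : ∀ y y′ → T (adjY y y′) → Fin (partsX (to y))
    labelY y y′ = labelX (to y) (to y′)

    to-injective : ∀ {y y′} → to y ≡ to y′ → y ≡ y′
    to-injective = Injection.injective (↔⇒↣ f)

  coronaOn-relabel :
    Iso (coronaOn adjY (partsX ∘ to) labelY)
        (coronaOn adjX partsX labelX)
  coronaOn-relabel = mk↔ₛ′ to′ from′ to∘from from∘to , adj⇔
    where
      to′ : CoronaVtx adjY (partsX ∘ to) labelY → CoronaVtx adjX partsX labelX
      to′ (external y) = external (to y)
      to′ (internal y A) = internal (to y) A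

      from′ : CoronaVtx adjX partsX labelX → CoronaVtx adjY (partsX ∘ to) labelY
      from′ (external x) = external (from x)
      from′ (internal x A) = internal (from x) (subst F (sym (strictlyInverseˡ x)) A)

      to∘from : ∀ v → to′ (from′ v) ≡ v
      to∘from (external x) = cong inj₁ (strictlyInverseˡ x)
      to∘from (internal x A) = cong inj₂ (over (strictlyInverseˡ x))
        where
          over : ∀ {x′} (eq : x′ ≡ x) → _≡_ {A = Σ X F} (x′ , subst F (sym eq) A) (x , A)
          over refl = refl

      from∘to : ∀ v → from′ (to′ v) ≡ v
      from∘to (external y) = cong inj₁ (strictlyInverseʳ y)
      from∘to (internal y A) = cong inj₂ (over (strictlyInverseʳ y) (strictlyInverseˡ (to y)))
        where
          over : ∀ {y′} → y′ ≡ y → (eq : to y′ ≡ to y) →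
            _≡_ {A = Σ Y (F ∘ to)} (y′ , subst F (sym eq) A) (y , A)
          over refl refl = refl

      adj⇔ : ∀ v v′ →
        CoronaAdj adjY (partsX ∘ to) labelY v v′ ⇔ CoronaAdj adjX partsX labelX (to′ v) (to′ v′)
      adj⇔ (external _) (external _) = mk⇔ id id
      adj⇔ (external _) (internal _ _) = mk⇔ (cong to) to-injective
      adj⇔ (internal _ _) (external _) = mk⇔ (cong to) to-injective
      adj⇔ (internal _ _) (internal _ _) = mk⇔ id id

-- One-point unions

-- The one-point union of A and B identifying a with b, on Vtx A ⊎ Vtx B;
-- the duplicate inj₂ b of inj₁ a is not a vertex of it.
module _ (A B : Graph) (a : Vtx A) (b : Vtx B) where

  WedgeAdj : Vtx A ⊎ Vtx B → Vtx A ⊎ Vtx B → Set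
  WedgeAdj (inj₁ p) (inj₁ q) = Adj A p q
  WedgeAdj (inj₁ p) (inj₂ q) = p ≡ a × Adj B b q
  WedgeAdj (inj₂ p) (inj₁ q) = q ≡ a × Adj B p b
  WedgeAdj (inj₂ p) (inj₂ q) = Adj B p q

  WedgeAdj-sym : (∀ p q → Adj A p q → Adj A q p) → (∀ p q → Adj B p q → Adj B q p) →
    ∀ p q → WedgeAdj p q → WedgeAdj q p
  WedgeAdj-sym A-sym B-sym (inj₁ p) (inj₁ q) = A-sym p q
  WedgeAdj-sym A-sym B-sym (inj₁ p) (inj₂ q) (p≡a , r) = p≡a , B-sym b q r
  WedgeAdj-sym A-sym B-sym (inj₂ p) (inj₁ q) (q≡a , r) = q≡a , B-sym p b r
  WedgeAdj-sym A-sym B-sym (inj₂ p) (inj₂ q) = B-sym p q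

  record IsWedge (K : Graph) : Set where
    field
      split : Vtx K → Vtx A ⊎ Vtx B
      merge : Vtx A ⊎ Vtx B → Vtx K
      split≢b : ∀ k → split k ≢ inj₂ b
      merge-split : ∀ k → merge (split k) ≡ k
      split-merge : ∀ p → p ≢ inj₂ b → split (merge p) ≡ p
      adj⇔wedge : ∀ k l → Adj K k l ⇔ WedgeAdj (split k) (split l)

IsWedge⇒Iso : ∀ {A B a b K K′} → IsWedge A B a b K → IsWedge A B a b K′ → Iso K K′
IsWedge⇒Iso {A} {B} {a} {b} {K} {K′} W W′ =
  mk↔ₛ′ (W′.merge ∘ W.split) (W.merge ∘ W′.split) inverseˡ inverseʳ , adj⇔
  where
    module W = IsWedge W
    module W′ = IsWedge W′

    split′-merge′-split : ∀ k → W′.split (W′.merge (W.split k)) ≡ W.split k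
    split′-merge′-split k = W′.split-merge _ (W.split≢b k)

    inverseˡ : ∀ k → W′.merge (W.split (W.merge (W′.split k))) ≡ k
    inverseˡ k = trans (cong W′.merge (W.split-merge _ (W′.split≢b k))) (W′.merge-split k)

    inverseʳ : ∀ k → W.merge (W′.split (W′.merge (W.split k))) ≡ k
    inverseʳ k = trans (cong W.merge (split′-merge′-split k)) (W.merge-split k)

    adj⇔ : ∀ k l → Adj K k l ⇔ Adj K′ (W′.merge (W.split k)) (W′.merge (W.split l))
    adj⇔ k l = ⇔-sym (subst₂ (λ p q → Adj K′ k′ l′ ⇔ WedgeAdj A B a b p q)
                              (split′-merge′-split k) (split′-merge′-split l) (W′.adj⇔wedge k′ l′))
               ⇔-∘ W.adj⇔wedge k l
      where
        k′ = W′.merge (W.split k)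
        l′ = W′.merge (W.split l)

module _ {U : Set} (G H : GraphIn U) (w : U) {A B : Graph} (a : Vtx A) (b : Vtx B)
  (φ : Iso A (asGraph G)) (ψ : Iso B (asGraph H))
  (φa≡w : proj₁ (Inverse.to (proj₁ φ) a) ≡ w) (ψb≡w : proj₁ (Inverse.to (proj₁ ψ) b) ≡ w)
  (G∩H⊆w : ∀ x → T (V G x) → T (V H x) → x ≡ w)
  (a-loopless : ¬ Adj A a a) (b-loopless : ¬ Adj B b b) where

  private
    module φ = Inverse (proj₁ φ)
    module ψ = Inverse (proj₁ ψ)

    φ′ : Vtx A → U
    φ′ = proj₁ ∘ φ.to

    ψ′ : Vtx B → U
    ψ′ = proj₁ ∘ ψ.to

    φ′-injective : ∀ {p q} → φ′ p ≡ φ′ q → p ≡ q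
    φ′-injective = Injection.injective (↔⇒↣ (proj₁ φ)) ∘ Σ-T-≡

    ψ′-injective : ∀ {p q} → ψ′ p ≡ ψ′ q → p ≡ q
    ψ′-injective = Injection.injective (↔⇒↣ (proj₁ ψ)) ∘ Σ-T-≡

    φ′∈H⇒≡a : ∀ p → T (V H (φ′ p)) → p ≡ a
    φ′∈H⇒≡a p p∈H = φ′-injective (trans (G∩H⊆w _ (proj₂ (φ.to p)) p∈H) (sym φa≡w))

    ψ′∈G⇒≡b : ∀ q → T (V G (ψ′ q)) → q ≡ b
    ψ′∈G⇒≡b q q∈G = ψ′-injective (trans (G∩H⊆w _ q∈G (proj₂ (ψ.to q))) (sym ψb≡w))

    w∈G : T (V G w)
    w∈G = subst (T ∘ V G) φa≡w (proj₂ (φ.to a))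

    EU : U → U → Set
    EU = E (G ∪ H)

    merge : Vtx A ⊎ Vtx B → Vtx (asGraph (G ∪ H))
    merge (inj₁ p) = φ′ p , Equivalence.from T-∨ (inj₁ (proj₂ (φ.to p)))
    merge (inj₂ q) = ψ′ q , Equivalence.from T-∨ (inj₂ (proj₂ (ψ.to q)))

    split : Vtx (asGraph (G ∪ H)) → Vtx A ⊎ Vtx B
    split (x , x∈G∪H) with T? (V G x)
    ... | yes x∈G = inj₁ (φ.from (x , x∈G))
    ... | no x∉G = inj₂ (ψ.from (x , [ ⊥-elim ∘ x∉G , id ] (Equivalence.to T-∨ x∈G∪H)))

    point : Vtx A ⊎ Vtx B → U
    point = proj₁ ∘ merge

    point-split : ∀ u → point (split u) ≡ proj₁ u
    point-split (x , _) with T? (V G x)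
    ... | yes _ = cong proj₁ (φ.strictlyInverseˡ _)
    ... | no _ = cong proj₁ (ψ.strictlyInverseˡ _)

    split≢b : ∀ u → split u ≢ inj₂ b
    split≢b (x , _) with T? (V G x)
    ... | yes _ = λ ()
    ... | no x∉G = λ eq → x∉G (subst (T ∘ V G) (sym (x≡w eq)) w∈G)
      where
        x≡w : ∀ {x∈H} → inj₂ (ψ.from (x , x∈H)) ≡ inj₂ b → x ≡ w
        x≡w eq = trans (sym (cong proj₁ (ψ.strictlyInverseˡ _)))
                       (trans (cong ψ′ (inj₂-injective eq)) ψb≡w)

    split-merge : ∀ p → p ≢ inj₂ b → split (merge p) ≡ p
    split-merge (inj₁ p) _ with T? (V G (φ′ p))
    ... | yes _ = cong inj₁ (trans (cong φ.from (Σ-T-≡ refl)) (φ.strictlyInverseʳ p))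
    ... | no p∉G = ⊥-elim (p∉G (proj₂ (φ.to p)))
    split-merge (inj₂ q) q≢b with T? (V G (ψ′ q))
    ... | yes q∈G = ⊥-elim (q≢b (cong inj₂ (ψ′∈G⇒≡b q q∈G)))
    ... | no _ = cong inj₂ (trans (cong ψ.from (Σ-T-≡ refl)) (ψ.strictlyInverseʳ q))

    E-H-within-A : ∀ p q → ¬ E H (φ′ p) (φ′ q)
    E-H-within-A p q e = b-loopless (Equivalence.from (proj₂ ψ b b)
      (subst₂ (E H) (at-b p (proj₁ (E-vert H _ _ e))) (at-b q (proj₂ (E-vert H _ _ e))) e))
      where
        at-b : ∀ r → T (V H (φ′ r)) → φ′ r ≡ ψ′ b
        at-b r r∈H = trans (G∩H⊆w _ (proj₂ (φ.to r)) r∈H) (sym ψb≡w)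

    E-G-within-B : ∀ p q → ¬ E G (ψ′ p) (ψ′ q)
    E-G-within-B p q e = a-loopless (Equivalence.from (proj₂ φ a a)
      (subst₂ (E G) (at-a p (proj₁ (E-vert G _ _ e))) (at-a q (proj₂ (E-vert G _ _ e))) e))
      where
        at-a : ∀ r → T (V G (ψ′ r)) → ψ′ r ≡ φ′ a
        at-a r r∈G = trans (G∩H⊆w _ r∈G (proj₂ (ψ.to r))) (sym φa≡w)

    φ′≡ψ′b : ∀ {p} → p ≡ a → φ′ p ≡ ψ′ b
    φ′≡ψ′b p≡a = trans (cong φ′ p≡a) (trans φa≡w (sym ψb≡w))

    wedge⇔union : ∀ p q → p ≢ inj₂ b → q ≢ inj₂ b → WedgeAdj A B a b p q ⇔ EU (point p) (point q)
    wedge⇔union (inj₁ p) (inj₁ q) _ _ = mk⇔ (inj₁ ∘ Equivalence.to (proj₂ φ p q))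
      [ Equivalence.from (proj₂ φ p q) , ⊥-elim ∘ E-H-within-A p q ]
    wedge⇔union (inj₂ p) (inj₂ q) _ _ = mk⇔ (inj₂ ∘ Equivalence.to (proj₂ ψ p q))
      [ ⊥-elim ∘ E-G-within-B p q , Equivalence.from (proj₂ ψ p q) ]
    wedge⇔union (inj₁ p) (inj₂ q) _ q≢b = mk⇔
      (λ (p≡a , r) →
         inj₂ (subst (λ z → E H z (ψ′ q)) (sym (φ′≡ψ′b p≡a)) (Equivalence.to (proj₂ ψ b q) r)))
      [ (λ e → ⊥-elim (q≢b (cong inj₂ (ψ′∈G⇒≡b q (proj₂ (E-vert G _ _ e))))))
      , (λ e → let p≡a = φ′∈H⇒≡a p (proj₁ (E-vert H _ _ e)) in
               p≡a , Equivalence.from (proj₂ ψ b q) (subst (λ z → E H z (ψ′ q)) (φ′≡ψ′b p≡a) e)) ]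
    wedge⇔union (inj₂ p) (inj₁ q) p≢b _ = mk⇔
      (λ (q≡a , r) → inj₂ (subst (E H (ψ′ p)) (sym (φ′≡ψ′b q≡a)) (Equivalence.to (proj₂ ψ p b) r)))
      [ (λ e → ⊥-elim (p≢b (cong inj₂ (ψ′∈G⇒≡b p (proj₁ (E-vert G _ _ e))))))
      , (λ e → let q≡a = φ′∈H⇒≡a q (proj₂ (E-vert H _ _ e)) in
               q≡a , Equivalence.from (proj₂ ψ p b) (subst (E H (ψ′ p)) (φ′≡ψ′b q≡a) e)) ]

  union-IsWedge : IsWedge A B a b (asGraph (G ∪ H))
  union-IsWedge = record
    { split = split
    ; merge = merge
    ; split≢b = split≢b
    ; merge-split = λ u → Σ-T-≡ (point-split u)
    ; split-merge = split-merge
    ; adj⇔wedge = λ u v → ⇔-sym (subst₂ (λ x y → WedgeAdj A B a b (split u) (split v) ⇔ EU x y)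
        (point-split u) (point-split v) (wedge⇔union (split u) (split v) (split≢b u) (split≢b v)))
    }

-- Gluing two trees at a vertex

Fin∖ : ∀ {n} → Fin n → Set
Fin∖ {n} v = Σ (Fin n) λ a → False (a ≟ v)

Fin∖↔ : ∀ {n} (v : Fin n) → Σ ℕ λ m → Fin m ↔ Fin∖ v
Fin∖↔ {suc m} v = m , mk↔ₛ′
  (λ i → punchIn v i , fromWitnessFalse (punchInᵢ≢i v i))
  (λ (a , a≢v) → punchOut (≢-sym (toWitnessFalse a≢v)))
  (λ _ → Σ-T-≡ (punchIn-punchOut _))
  (λ i → trans (punchOut-cong v refl) (punchOut-punchIn v))

loopless-T : (t : Tree) (v : Fin (size t)) → ¬ T (adj t v v)
loopless-T t v = subst T (loopless t v)

module Glue (t₁ t₂ : Tree) (P₁ : VNPartition t₁) (P₂ : VNPartition t₂)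
  (v₁ : Fin (size t₁)) (v₂ : Fin (size t₂)) where

  Glued : Set
  Glued = ⊤ ⊎ (Fin∖ v₁ ⊎ Fin∖ v₂)

  pattern centre = inj₁ tt
  pattern left a p = inj₂ (inj₁ (a , p))
  pattern right b p = inj₂ (inj₂ (b , p))

  N : ℕ
  N = suc (proj₁ (Fin∖↔ v₁) + proj₁ (Fin∖↔ v₂))

  Fin↔Glued : Fin N ↔ Glued
  Fin↔Glued = (1↔⊤ ⊎-↔ ((proj₂ (Fin∖↔ v₁) ⊎-↔ proj₂ (Fin∖↔ v₂)) ↔-∘ +↔⊎)) ↔-∘ +↔⊎

  open Inverse Fin↔Glued using () renaming (to to vertex; from to index;
    strictlyInverseˡ to vertex-index; strictlyInverseʳ to index-vertex)

  gluedAdj : Glued → Glued → Bool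
  gluedAdj centre centre = false
  gluedAdj centre (left a _) = adj t₁ v₁ a
  gluedAdj centre (right b _) = adj t₂ v₂ b
  gluedAdj (left a _) centre = adj t₁ a v₁
  gluedAdj (left a _) (left a′ _) = adj t₁ a a′
  gluedAdj (left _ _) (right _ _) = false
  gluedAdj (right b _) centre = adj t₂ b v₂
  gluedAdj (right _ _) (left _ _) = false
  gluedAdj (right b _) (right b′ _) = adj t₂ b b′

  gluedAdj-sym : ∀ s s′ → T (gluedAdj s s′) → T (gluedAdj s′ s)
  gluedAdj-sym centre (left _ _) = symmetric t₁ _ _
  gluedAdj-sym centre (right _ _) = symmetric t₂ _ _
  gluedAdj-sym (left _ _) centre = symmetric t₁ _ _
  gluedAdj-sym (left _ _) (left _ _) = symmetric t₁ _ _
  gluedAdj-sym (right _ _) centre = symmetric t₂ _ _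
  gluedAdj-sym (right _ _) (right _ _) = symmetric t₂ _ _

  gluedAdj-loopless : ∀ s → gluedAdj s s ≡ false
  gluedAdj-loopless centre = refl
  gluedAdj-loopless (left a _) = loopless t₁ a
  gluedAdj-loopless (right b _) = loopless t₂ b

  -- Defined through an explicit decision (as are mergeˡ-by and mergeʳ-by below):
  -- abstracting a ≟ v₁ with 'with' is ill-typed when some p : False (a ≟ v₁)
  -- is in scope.
  embedˡ-by : ∀ a → Dec (a ≡ v₁) → Glued
  embedˡ-by a (yes _) = centre
  embedˡ-by a (no a≢v₁) = left a (fromWitnessFalse a≢v₁)

  embedʳ-by : ∀ b → Dec (b ≡ v₂) → Glued
  embedʳ-by b (yes _) = centre
  embedʳ-by b (no b≢v₂) = right b (fromWitnessFalse b≢v₂)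

  embedˡ : Fin (size t₁) → Glued
  embedˡ a = embedˡ-by a (a ≟ v₁)

  embedʳ : Fin (size t₂) → Glued
  embedʳ b = embedʳ-by b (b ≟ v₂)

  embedˡ-v₁ : embedˡ v₁ ≡ centre
  embedˡ-v₁ with v₁ ≟ v₁
  ... | yes _ = refl
  ... | no v₁≢v₁ = ⊥-elim (v₁≢v₁ refl)

  embedʳ-v₂ : embedʳ v₂ ≡ centre
  embedʳ-v₂ with v₂ ≟ v₂
  ... | yes _ = refl
  ... | no v₂≢v₂ = ⊥-elim (v₂≢v₂ refl)

  embedˡ-left : ∀ a p → embedˡ a ≡ left a p
  embedˡ-left a p = by (a ≟ v₁)
    where
      by : ∀ d → embedˡ-by a d ≡ left a p
      by (yes a≡v₁) = ⊥-elim (toWitnessFalse p a≡v₁)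
      by (no _) = cong (inj₂ ∘ inj₁) (Σ-T-≡ refl)

  embedʳ-right : ∀ b p → embedʳ b ≡ right b p
  embedʳ-right b p = by (b ≟ v₂)
    where
      by : ∀ d → embedʳ-by b d ≡ right b p
      by (yes b≡v₂) = ⊥-elim (toWitnessFalse p b≡v₂)
      by (no _) = cong (inj₂ ∘ inj₂) (Σ-T-≡ refl)

  embedˡ-edge : ∀ {a a′} → T (adj t₁ a a′) → T (gluedAdj (embedˡ a) (embedˡ a′))
  embedˡ-edge {a} {a′} e with a ≟ v₁ | a′ ≟ v₁
  ... | yes refl | yes refl = ⊥-elim (loopless-T t₁ a e)
  ... | yes refl | no _ = e
  ... | no _ | yes refl = e
  ... | no _ | no _ = e

  embedʳ-edge : ∀ {b b′} → T (adj t₂ b b′) → T (gluedAdj (embedʳ b) (embedʳ b′))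
  embedʳ-edge {b} {b′} e with b ≟ v₂ | b′ ≟ v₂
  ... | yes refl | yes refl = ⊥-elim (loopless-T t₂ b e)
  ... | yes refl | no _ = e
  ... | no _ | yes refl = e
  ... | no _ | no _ = e

  treeAdj : Fin N → Fin N → Bool
  treeAdj x y = gluedAdj (vertex x) (vertex y)

  edge-index : ∀ {s s′} → T (gluedAdj s s′) → Edge treeAdj (index s) (index s′)
  edge-index {s} {s′} =
    subst₂ (λ s s′ → T (gluedAdj s s′)) (sym (vertex-index s)) (sym (vertex-index s′))

  walkˡ : ∀ {a a′} → Walk (adj t₁) a a′ → Walk treeAdj (index (embedˡ a)) (index (embedˡ a′))
  walkˡ = mapWalk (index ∘ embedˡ) λ {a} {a′} e → edge-index {embedˡ a} {embedˡ a′} (embedˡ-edge e)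

  walkʳ : ∀ {b b′} → Walk (adj t₂) b b′ → Walk treeAdj (index (embedʳ b)) (index (embedʳ b′))
  walkʳ = mapWalk (index ∘ embedʳ) λ {b} {b′} e → edge-index {embedʳ b} {embedʳ b′} (embedʳ-edge e)

  private
    Walkᴳ : Glued → Glued → Set
    Walkᴳ s s′ = Walk treeAdj (index s) (index s′)

  walk-to-centre : ∀ s → Walkᴳ s centre
  walk-to-centre centre = here
  walk-to-centre (left a p) = subst₂ Walkᴳ (embedˡ-left a p) embedˡ-v₁ (walkˡ (connected t₁ a v₁))
  walk-to-centre (right b p) = subst₂ Walkᴳ (embedʳ-right b p) embedʳ-v₂ (walkʳ (connected t₂ b v₂))

  walk-from-centre : ∀ s → Walkᴳ centre s
  walk-from-centre centre = here
  walk-from-centre (left a p) = subst₂ Walkᴳ embedˡ-v₁ (embedˡ-left a p) (walkˡ (connected t₁ v₁ a))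
  walk-from-centre (right b p) = subst₂ Walkᴳ embedʳ-v₂ (embedʳ-right b p) (walkʳ (connected t₂ v₂ b))

  tree-connected : ∀ x y → Walk treeAdj x y
  tree-connected x y = subst₂ (Walk treeAdj) (index-vertex x) (index-vertex y)
    (walk-to-centre (vertex x) ◅◅ walk-from-centre (vertex y))

  -- The value at the centre is arbitrary: the centre is the cut vertex.
  isLeft : Glued → Bool
  isLeft (right _ _) = false
  isLeft _ = true

  gluedAdj-sameSide : ∀ s s′ → T (gluedAdj s s′) → s ≢ centre → s′ ≢ centre → isLeft s ≡ isLeft s′
  gluedAdj-sameSide centre _ _ s≢c _ = ⊥-elim (s≢c refl)
  gluedAdj-sameSide _ centre _ _ s′≢c = ⊥-elim (s′≢c refl)
  gluedAdj-sameSide (left _ _) (left _ _) _ _ _ = refl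
  gluedAdj-sameSide (right _ _) (right _ _) _ _ _ = refl

  OnSide : Bool → Glued → Set
  OnSide side s = s ≢ centre → isLeft s ≡ side

  projectˡ : Glued → Fin (size t₁)
  projectˡ (left a _) = a
  projectˡ _ = v₁

  projectʳ : Glued → Fin (size t₂)
  projectʳ (right b _) = b
  projectʳ _ = v₂

  ¬OnSide-true-right : ∀ {b p} → ¬ OnSide true (right b p)
  ¬OnSide-true-right onLeft with onLeft (λ ())
  ... | ()

  ¬OnSide-false-left : ∀ {a p} → ¬ OnSide false (left a p)
  ¬OnSide-false-left onRight with onRight (λ ())
  ... | ()

  projectˡ-injective : ∀ {s s′} → OnSide true s → OnSide true s′ → projectˡ s ≡ projectˡ s′ → s ≡ s′
  projectˡ-injective {centre} {centre} _ _ _ = refl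
  projectˡ-injective {centre} {left a p} _ _ v₁≡a = ⊥-elim (toWitnessFalse p (sym v₁≡a))
  projectˡ-injective {left a p} {centre} _ _ a≡v₁ = ⊥-elim (toWitnessFalse p a≡v₁)
  projectˡ-injective {left a p} {left a′ p′} _ _ a≡a′ = cong (inj₂ ∘ inj₁) (Σ-T-≡ a≡a′)
  projectˡ-injective {right _ _} o _ _ = ⊥-elim (¬OnSide-true-right o)
  projectˡ-injective {_} {right _ _} _ o _ = ⊥-elim (¬OnSide-true-right o)

  projectʳ-injective : ∀ {s s′} → OnSide false s → OnSide false s′ → projectʳ s ≡ projectʳ s′ → s ≡ s′
  projectʳ-injective {centre} {centre} _ _ _ = refl
  projectʳ-injective {centre} {right b p} _ _ v₂≡b = ⊥-elim (toWitnessFalse p (sym v₂≡b))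
  projectʳ-injective {right b p} {centre} _ _ b≡v₂ = ⊥-elim (toWitnessFalse p b≡v₂)
  projectʳ-injective {right b p} {right b′ p′} _ _ b≡b′ = cong (inj₂ ∘ inj₂) (Σ-T-≡ b≡b′)
  projectʳ-injective {left _ _} o _ _ = ⊥-elim (¬OnSide-false-left o)
  projectʳ-injective {_} {left _ _} _ o _ = ⊥-elim (¬OnSide-false-left o)

  projectˡ-edge : ∀ {s s′} → OnSide true s → OnSide true s′ →
    T (gluedAdj s s′) → T (adj t₁ (projectˡ s) (projectˡ s′))
  projectˡ-edge {centre} {left _ _} _ _ e = e
  projectˡ-edge {left _ _} {centre} _ _ e = e
  projectˡ-edge {left _ _} {left _ _} _ _ e = e
  projectˡ-edge {right _ _} o _ _ = ⊥-elim (¬OnSide-true-right o)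
  projectˡ-edge {_} {right _ _} _ o _ = ⊥-elim (¬OnSide-true-right o)

  projectʳ-edge : ∀ {s s′} → OnSide false s → OnSide false s′ →
    T (gluedAdj s s′) → T (adj t₂ (projectʳ s) (projectʳ s′))
  projectʳ-edge {centre} {right _ _} _ _ e = e
  projectʳ-edge {right _ _} {centre} _ _ e = e
  projectʳ-edge {right _ _} {right _ _} _ _ e = e
  projectʳ-edge {left _ _} o _ _ = ⊥-elim (¬OnSide-false-left o)
  projectʳ-edge {_} {left _ _} _ o _ = ⊥-elim (¬OnSide-false-left o)

  vertex-injective : ∀ {x y} → vertex x ≡ vertex y → x ≡ y
  vertex-injective = Injection.injective (↔⇒↣ Fin↔Glued)

  private
    centre-index : ∀ {x} → vertex x ≡ centre → index centre ≡ x
    centre-index {x} eq = trans (cong index (sym eq)) (index-vertex x)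

  module Cut = CutVertex _≟_ (Edge treeAdj) (index centre) (isLeft ∘ vertex)
    (λ {x} {y} e c≢x c≢y →
       gluedAdj-sameSide (vertex x) (vertex y) e (c≢x ∘ centre-index) (c≢y ∘ centre-index))

  onSide-vertex : ∀ {side x} → Cut.OnSide side x → OnSide side (vertex x)
  onSide-vertex o v≢c = o (λ eq → v≢c (trans (cong vertex (sym eq)) (vertex-index centre)))

  tree-acyclic : ¬ Cycle treeAdj
  tree-acyclic cyc@(xs , _ , u , lk) with Cut.cycle-oneSided xs u lk
  ... | true , onLeft = acyclic t₁ (mapCycle (OnSide true ∘ vertex) (projectˡ ∘ vertex)
    (λ o o′ → vertex-injective ∘ projectˡ-injective o o′) projectˡ-edge
    cyc (All.map onSide-vertex onLeft))
  ... | false , onRight = acyclic t₂ (mapCycle (OnSide false ∘ vertex) (projectʳ ∘ vertex)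
    (λ o o′ → vertex-injective ∘ projectʳ-injective o o′) projectʳ-edge
    cyc (All.map onSide-vertex onRight))

  tree : Tree
  tree = record
    { size = N
    ; nonempty = s≤s z≤n
    ; adj = treeAdj
    ; symmetric = λ x y → gluedAdj-sym (vertex x) (vertex y)
    ; loopless = gluedAdj-loopless ∘ vertex
    ; connected = tree-connected
    ; acyclic = tree-acyclic
    }

  gluedParts : Glued → ℕ
  gluedParts centre = parts P₁ v₁ + parts P₂ v₂
  gluedParts (left a _) = parts P₁ a
  gluedParts (right b _) = parts P₂ b

  gluedLabel : ∀ s s′ → T (gluedAdj s s′) → Fin (gluedParts s)
  gluedLabel centre (left a _) e = label P₁ v₁ a e ↑ˡ parts P₂ v₂
  gluedLabel centre (right b _) e = parts P₁ v₁ ↑ʳ label P₂ v₂ b e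
  gluedLabel (left a _) centre e = label P₁ a v₁ e
  gluedLabel (left a _) (left a′ _) e = label P₁ a a′ e
  gluedLabel (right b _) centre e = label P₂ b v₂ e
  gluedLabel (right b _) (right b′ _) e = label P₂ b b′ e

  PartWitness : (s : Glued) → Fin (gluedParts s) → Glued → Set
  PartWitness s A s′ = Σ (T (gluedAdj s s′)) λ e → gluedLabel s s′ e ≡ A

  gluedParts-nonempty : ∀ s A → Σ Glued (PartWitness s A)
  gluedParts-nonempty (left a _) A with nonemptyParts P₁ a A
  ... | u , e , l with u ≟ v₁
  ...   | yes refl = centre , e , l
  ...   | no u≢v₁ = left u (fromWitnessFalse u≢v₁) , e , l
  gluedParts-nonempty (right b _) B with nonemptyParts P₂ b B
  ... | u , e , l with u ≟ v₂
  ...   | yes refl = centre , e , l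
  ...   | no u≢v₂ = right u (fromWitnessFalse u≢v₂) , e , l
  gluedParts-nonempty centre A with splitAt (parts P₁ v₁) A in eq
  ... | inj₁ A₁ with nonemptyParts P₁ v₁ A₁
  ...   | u , e , l with u ≟ v₁
  ...     | yes refl = ⊥-elim (loopless-T t₁ u e)
  ...     | no u≢v₁ = left u (fromWitnessFalse u≢v₁) , e ,
                        trans (cong (_↑ˡ parts P₂ v₂) l) (splitAt⁻¹-↑ˡ eq)
  gluedParts-nonempty centre A | inj₂ A₂ with nonemptyParts P₂ v₂ A₂
  ...   | u , e , l with u ≟ v₂
  ...     | yes refl = ⊥-elim (loopless-T t₂ u e)
  ...     | no u≢v₂ = right u (fromWitnessFalse u≢v₂) , e ,
                        trans (cong (parts P₁ v₁ ↑ʳ_) l) (splitAt⁻¹-↑ʳ eq)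

  part : VNPartition tree
  part = record
    { parts = gluedParts ∘ vertex
    ; label = λ x y → gluedLabel (vertex x) (vertex y)
    ; nonemptyParts = λ x A → let s , w = gluedParts-nonempty (vertex x) A in
        index s , subst (PartWitness (vertex x) A) (sym (vertex-index s)) w
    }

  gluedCorona : Graph
  gluedCorona = coronaOn gluedAdj gluedParts gluedLabel

  private
    C₁ C₂ : Set
    C₁ = CVtx t₁ P₁
    C₂ = CVtx t₂ P₂

    Wedge : C₁ ⊎ C₂ → C₁ ⊎ C₂ → Set
    Wedge = WedgeAdj (corona t₁ P₁) (corona t₂ P₂) (external v₁) (external v₂)

  splitCentre : Fin (parts P₁ v₁) ⊎ Fin (parts P₂ v₂) → C₁ ⊎ C₂
  splitCentre (inj₁ A) = inj₁ (internal v₁ A)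
  splitCentre (inj₂ B) = inj₂ (internal v₂ B)

  split : Vtx gluedCorona → C₁ ⊎ C₂
  split (external centre) = inj₁ (external v₁)
  split (external (left a _)) = inj₁ (external a)
  split (external (right b _)) = inj₂ (external b)
  split (internal centre A) = splitCentre (splitAt (parts P₁ v₁) A)
  split (internal (left a _) A) = inj₁ (internal a A)
  split (internal (right b _) B) = inj₂ (internal b B)

  mergeˡ-by : ∀ a → Dec (a ≡ v₁) → Fin (parts P₁ a) → Vtx gluedCorona
  mergeˡ-by a (yes refl) A = internal centre (A ↑ˡ parts P₂ v₂)
  mergeˡ-by a (no a≢v₁) A = internal (left a (fromWitnessFalse a≢v₁)) A

  mergeʳ-by : ∀ b → Dec (b ≡ v₂) → Fin (parts P₂ b) → Vtx gluedCorona
  mergeʳ-by b (yes refl) B = internal centre (parts P₁ v₁ ↑ʳ B)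
  mergeʳ-by b (no b≢v₂) B = internal (right b (fromWitnessFalse b≢v₂)) B

  merge : C₁ ⊎ C₂ → Vtx gluedCorona
  merge (inj₁ (external a)) = external (embedˡ a)
  merge (inj₁ (internal a A)) = mergeˡ-by a (a ≟ v₁) A
  merge (inj₂ (external b)) = external (embedʳ b)
  merge (inj₂ (internal b B)) = mergeʳ-by b (b ≟ v₂) B

  split≢v₂ : ∀ k → split k ≢ inj₂ (external v₂)
  split≢v₂ (external centre) ()
  split≢v₂ (external (left _ _)) ()
  split≢v₂ (external (right b p)) eq = toWitnessFalse p (inj₁-injective (inj₂-injective eq))
  split≢v₂ (internal centre A) = splitCentre≢ (splitAt (parts P₁ v₁) A)
    where
      splitCentre≢ : ∀ x → splitCentre x ≢ inj₂ (external v₂)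
      splitCentre≢ (inj₁ _) ()
      splitCentre≢ (inj₂ _) ()
  split≢v₂ (internal (left _ _) _) ()
  split≢v₂ (internal (right _ _) _) ()

  merge-split : ∀ k → merge (split k) ≡ k
  merge-split (external centre) = cong inj₁ embedˡ-v₁
  merge-split (external (left a p)) = cong inj₁ (embedˡ-left a p)
  merge-split (external (right b p)) = cong inj₁ (embedʳ-right b p)
  merge-split (internal centre A) with splitAt (parts P₁ v₁) A in eq
  ... | inj₁ A₁ with v₁ ≟ v₁
  ...   | yes refl = cong (internal centre) (splitAt⁻¹-↑ˡ eq)
  ...   | no v₁≢v₁ = ⊥-elim (v₁≢v₁ refl)
  merge-split (internal centre A) | inj₂ A₂ with v₂ ≟ v₂
  ...   | yes refl = cong (internal centre) (splitAt⁻¹-↑ʳ eq)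
  ...   | no v₂≢v₂ = ⊥-elim (v₂≢v₂ refl)
  merge-split (internal (left a p) A) = by (a ≟ v₁)
    where
      by : ∀ d → mergeˡ-by a d A ≡ internal (left a p) A
      by (yes a≡v₁) = ⊥-elim (toWitnessFalse p a≡v₁)
      by (no _) = cong (λ p → internal (left a p) A) (T-irrelevant _ _)
  merge-split (internal (right b p) B) = by (b ≟ v₂)
    where
      by : ∀ d → mergeʳ-by b d B ≡ internal (right b p) B
      by (yes b≡v₂) = ⊥-elim (toWitnessFalse p b≡v₂)
      by (no _) = cong (λ p → internal (right b p) B) (T-irrelevant _ _)

  split-merge : ∀ c → c ≢ inj₂ (external v₂) → split (merge c) ≡ c
  split-merge (inj₁ (external a)) _ with a ≟ v₁
  ... | yes refl = refl
  ... | no _ = refl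
  split-merge (inj₁ (internal a A)) _ with a ≟ v₁
  ... | yes refl = cong splitCentre (splitAt-↑ˡ (parts P₁ v₁) A (parts P₂ v₂))
  ... | no _ = refl
  split-merge (inj₂ (external b)) c≢v₂ with b ≟ v₂
  ... | yes refl = ⊥-elim (c≢v₂ refl)
  ... | no _ = refl
  split-merge (inj₂ (internal b B)) _ with b ≟ v₂
  ... | yes refl = cong splitCentre (splitAt-↑ʳ (parts P₁ v₁) (parts P₂ v₂) B)
  ... | no _ = refl

  private
    splitAt-↑ˡ-≡ : ∀ {m n} {i : Fin m} {j : Fin (m + n)} → i ↑ˡ n ≡ j → splitAt m j ≡ inj₁ i
    splitAt-↑ˡ-≡ {m} {n} {i} refl = splitAt-↑ˡ m i n

    splitAt-↑ʳ-≡ : ∀ {m n} {i : Fin n} {j : Fin (m + n)} → m ↑ʳ i ≡ j → splitAt m j ≡ inj₂ i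
    splitAt-↑ʳ-≡ {m} {n} {i} refl = splitAt-↑ʳ m n i

  flip⇔ : ∀ {k l} → Adj gluedCorona k l ⇔ Wedge (split k) (split l) →
                    Adj gluedCorona l k ⇔ Wedge (split l) (split k)
  flip⇔ {k} {l} r = mk⇔
    (wedge-sym (split k) (split l) ∘ Equivalence.to r ∘ CoronaAdj-sym gluedAdj gluedParts gluedLabel l k)
    (CoronaAdj-sym gluedAdj gluedParts gluedLabel k l ∘ Equivalence.from r ∘ wedge-sym (split l) (split k))
    where
      wedge-sym : ∀ c d → Wedge c d → Wedge d c
      wedge-sym = WedgeAdj-sym _ _ _ _ (CAdj-sym t₁ P₁) (CAdj-sym t₂ P₂)

  external-external : ∀ s s′ → ¬ Wedge (split (external s)) (split (external s′))
  external-external centre centre ()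
  external-external centre (left _ _) ()
  external-external centre (right _ _) (_ , ())
  external-external (left _ _) centre ()
  external-external (left _ _) (left _ _) ()
  external-external (left _ _) (right _ _) (_ , ())
  external-external (right _ _) centre (_ , ())
  external-external (right _ _) (left _ _) (_ , ())
  external-external (right _ _) (right _ _) ()

  external-internal : ∀ s s′ A → (s ≡ s′) ⇔ Wedge (split (external s)) (split (internal s′ A))
  external-internal centre centre A = mk⇔ (λ _ → adjacent (splitAt (parts P₁ v₁) A)) (λ _ → refl)
    where
      adjacent : ∀ x → Wedge (inj₁ (external v₁)) (splitCentre x)
      adjacent (inj₁ _) = refl
      adjacent (inj₂ _) = refl , refl
  external-internal centre (left a p) _ = mk⇔ (λ ()) (λ v₁≡a → ⊥-elim (toWitnessFalse p (sym v₁≡a)))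
  external-internal centre (right b p) _ = mk⇔ (λ ()) (λ (_ , v₂≡b) → ⊥-elim (toWitnessFalse p (sym v₂≡b)))
  external-internal (left a p) centre A = mk⇔ (λ ()) (⊥-elim ∘ nonadjacent (splitAt (parts P₁ v₁) A))
    where
      nonadjacent : ∀ x → ¬ Wedge (inj₁ (external a)) (splitCentre x)
      nonadjacent (inj₁ _) a≡v₁ = toWitnessFalse p a≡v₁
      nonadjacent (inj₂ _) (a≡v₁ , _) = toWitnessFalse p (inj₁-injective a≡v₁)
  external-internal (left _ _) (left _ _) _ = mk⇔ (cong projectˡ) (cong (inj₂ ∘ inj₁) ∘ Σ-T-≡)
  external-internal (left a p) (right _ _) _ =
    mk⇔ (λ ()) (λ (a≡v₁ , _) → ⊥-elim (toWitnessFalse p (inj₁-injective a≡v₁)))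
  external-internal (right b p) centre A = mk⇔ (λ ()) (⊥-elim ∘ nonadjacent (splitAt (parts P₁ v₁) A))
    where
      nonadjacent : ∀ x → ¬ Wedge (inj₂ (external b)) (splitCentre x)
      nonadjacent (inj₁ _) (_ , ())
      nonadjacent (inj₂ _) b≡v₂ = toWitnessFalse p b≡v₂
  external-internal (right _ _) (left _ _) _ = mk⇔ (λ ()) (λ { (_ , ()) })
  external-internal (right _ _) (right _ _) _ = mk⇔ (cong projectʳ) (cong (inj₂ ∘ inj₂) ∘ Σ-T-≡)

  centre-left : ∀ a p A B → Adj gluedCorona (internal centre A) (internal (left a p) B) ⇔
                            Wedge (split (internal centre A)) (inj₁ (internal a B))
  centre-left a p A B with splitAt (parts P₁ v₁) A in eq
  ... | inj₁ A₁ = mk⇔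
    (λ (e , e′ , l , l′) → e , e′ , inj₁-injective (trans (sym (splitAt-↑ˡ-≡ l)) eq) , l′)
    (λ (e , e′ , l , l′) → e , e′ , trans (cong (_↑ˡ parts P₂ v₂) l) (splitAt⁻¹-↑ˡ eq) , l′)
  ... | inj₂ _ = mk⇔ (λ (_ , _ , l , _) → case trans (sym (splitAt-↑ˡ-≡ l)) eq of λ ()) (λ { (() , _) })

  centre-right : ∀ b p A B → Adj gluedCorona (internal centre A) (internal (right b p) B) ⇔
                             Wedge (split (internal centre A)) (inj₂ (internal b B))
  centre-right b p A B with splitAt (parts P₁ v₁) A in eq
  ... | inj₂ A₂ = mk⇔
    (λ (e , e′ , l , l′) → e , e′ , inj₂-injective (trans (sym (splitAt-↑ʳ-≡ l)) eq) , l′)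
    (λ (e , e′ , l , l′) → e , e′ , trans (cong (parts P₁ v₁ ↑ʳ_) l) (splitAt⁻¹-↑ʳ eq) , l′)
  ... | inj₁ _ = mk⇔ (λ (_ , _ , l , _) → case trans (sym (splitAt-↑ʳ-≡ l)) eq of λ ()) (λ { (() , _) })

  internal-internal : ∀ s s′ A B →
    Adj gluedCorona (internal s A) (internal s′ B) ⇔ Wedge (split (internal s A)) (split (internal s′ B))
  internal-internal centre centre A B =
    mk⇔ (λ { (() , _) }) (⊥-elim ∘ loop (splitAt (parts P₁ v₁) A) (splitAt (parts P₁ v₁) B))
    where
      loop : ∀ x y → ¬ Wedge (splitCentre x) (splitCentre y)
      loop (inj₁ _) (inj₁ _) (e , _) = loopless-T t₁ v₁ e
      loop (inj₁ _) (inj₂ _) (() , _)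
      loop (inj₂ _) (inj₁ _) (() , _)
      loop (inj₂ _) (inj₂ _) (e , _) = loopless-T t₂ v₂ e
  internal-internal centre (left a p) A B = centre-left a p A B
  internal-internal centre (right b p) A B = centre-right b p A B
  internal-internal (left a p) centre A B =
    flip⇔ {internal centre B} {internal (left a p) A} (centre-left a p B A)
  internal-internal (right b p) centre A B =
    flip⇔ {internal centre B} {internal (right b p) A} (centre-right b p B A)
  internal-internal (left _ _) (left _ _) _ _ = mk⇔ id id
  internal-internal (right _ _) (right _ _) _ _ = mk⇔ id id
  internal-internal (left _ _) (right _ _) _ _ = mk⇔ (λ { (() , _) }) (λ { (() , _) })
  internal-internal (right _ _) (left _ _) _ _ = mk⇔ (λ { (() , _) }) (λ { (() , _) })

  adj⇔wedge : ∀ k l → Adj gluedCorona k l ⇔ Wedge (split k) (split l)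
  adj⇔wedge (external s) (external s′) = mk⇔ (λ ()) (external-external s s′)
  adj⇔wedge (external s) (internal s′ A) = external-internal s s′ A
  adj⇔wedge (internal s A) (external s′) = flip⇔ {external s′} {internal s A} (external-internal s′ s A)
  adj⇔wedge (internal s A) (internal s′ B) = internal-internal s s′ A B

  corona-IsWedge : IsWedge (corona t₁ P₁) (corona t₂ P₂) (external v₁) (external v₂) gluedCorona
  corona-IsWedge = record
    { split = split
    ; merge = merge
    ; split≢b = split≢v₂
    ; merge-split = merge-split
    ; split-merge = split-merge
    ; adj⇔wedge = adj⇔wedge
    }

mainTheorem3 : {U : Set} (G H : GraphIn U) (w : U)
    (t₁ : Tree) (P₁ : VNPartition t₁) (φ₁ : Iso (corona t₁ P₁) (asGraph G))
    (t₂ : Tree) (P₂ : VNPartition t₂) (φ₂ : Iso (corona t₂ P₂) (asGraph H))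
    (v₁ : CVtxExt t₁) (v₂ : CVtxExt t₂) →
    proj₁ (Inverse.to (proj₁ φ₁) (ext t₁ P₁ v₁)) ≡ w →
    proj₁ (Inverse.to (proj₁ φ₂) (ext t₂ P₂ v₂)) ≡ w →
    (∀ x → T (V G x) → T (V H x) → x ≡ w) →
    IsGeneralCoronaOfTree (asGraph (G ∪ H))
mainTheorem3 G H w t₁ P₁ φ₁ t₂ P₂ φ₂ v₁ v₂ φ₁v₁≡w φ₂v₂≡w G∩H⊆w = tree , part , (begin
    corona tree part                               ≅⟨ corona≅coronaOn tree part ⟩
    coronaOn (adj tree) (parts part) (label part)  ≅⟨ coronaOn-relabel Fin↔Glued ⟩
    gluedCorona                                    ≅⟨ IsWedge⇒Iso corona-IsWedge G∪H-IsWedge ⟩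
    asGraph (G ∪ H)                                ∎)
  where
    open Glue t₁ t₂ P₁ P₂ v₁ v₂
    open Iso-Reasoning

    G∪H-IsWedge : IsWedge (corona t₁ P₁) (corona t₂ P₂) (external v₁) (external v₂) (asGraph (G ∪ H))
    G∪H-IsWedge = union-IsWedge G H w (external v₁) (external v₂) φ₁ φ₂ φ₁v₁≡w φ₂v₂≡w G∩H⊆w (λ ()) (λ ())
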